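{- Let $r\ge1$ be an integer. Define the $r$-Lah polynomials $\mathcal{L}_{n,r}(x)$ by $\sum_{n\ge0}\mathcal{L}_{n,r}(x)\frac{t^n}{n!}=\frac{1}{(1-t)^{2r}}\exp\!\left(\frac{xt}{1-t}\right)$, let $\mathcal{L}_{n,r}=\mathcal{L}_{n,r}(1)$, and define the modified $r$-Lah polynomials $\mathcal{P}_{n,r}(x)=\sum_{k=0}^n\binom nk\mathcal{L}_{k,r}x^{n-k}$. Let $n\ge1$, $s\ge1$, $m\ge0$ be integers and $p\ge3$ a prime. Then $$\mathcal{P}_{n+mp^s,r}(x)\equiv\left(x^{p^s}+1\right)^m\mathcal{P}_{n,r}(x)\pmod p,$$ and in particular $\mathcal{L}_{n+mp^s,r}\equiv\mathcal{L}_{n,r}\pmod p$.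
   Context: A congruence $P(x)\equiv Q(x)\pmod p$ between polynomials with integer coefficients means that every coefficient of $P(x)-Q(x)$ is divisible by $p$. Explicitly $\mathcal{L}_{n,r}(x)=\sum_{k=0}^nL_r(n,k)x^k$ where $L_r(n,k)=\binom nk\frac{(n+2r-1)!}{(k+2r-1)!}$ are the $r$-Lah numbers, so $\mathcal{L}_{n,r}$ are integers. The polynomials $\mathcal{P}_{n,r}(x)$ have exponential generating function $\frac{1}{(1-t)^{2r}}\exp\!\left(\frac{t}{1-t}\right)e^{xt}$. -}

module Defs where

open import Data.Nat using (ℕ; zero; suc; _+_; _*_; _∸_; _^_; _≤ᵇ_; _/_; _!)
open import Data.Nat.Properties using (_!≢0)
open import Data.Nat.Combinatorics using (_C_)
open import Data.Bool using (if_then_else_)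
open import Data.Integer using (ℤ; +_; _-_)
open import Data.Integer.Divisibility using (_∣_)

sumTo : ℕ → (ℕ → ℕ) → ℕ
sumTo zero    f = f 0
sumTo (suc n) f = sumTo n f + f (suc n)

rLah : ℕ → ℕ → ℕ → ℕ
rLah r n k = (n C k) * ((n + 2 * r ∸ 1) ! / (k + 2 * r ∸ 1) !)
  where instance _ = (k + 2 * r ∸ 1) !≢0

-- 𝓛_{n,r} = 𝓛_{n,r}(1) = Σ_k L_r(n,k)
lahNum : ℕ → ℕ → ℕ
lahNum r n = sumTo n (rLah r n)

-- Polynomials with natural-number coefficients, represented by their
-- coefficient function (coefficient of x^j); all polynomials used are
-- finitely supported.
Poly : Set
Poly = ℕ → ℕ

_⊛_ : Poly → Poly → Poly
(f ⊛ g) j = sumTo j (λ i → f i * g (j ∸ i))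

one : Poly
one zero    = 1
one (suc _) = 0

_⊛^_ : Poly → ℕ → Poly
f ⊛^ zero  = one
f ⊛^ suc m = f ⊛ (f ⊛^ m)

-- the polynomial x^q + 1
xPow+1 : ℕ → Poly
xPow+1 q j = (if j ≤ᵇ q then (if q ≤ᵇ j then 1 else 0) else 0)
           + (if j ≤ᵇ 0 then 1 else 0)

-- modified r-Lah polynomial  𝓟_{n,r}(x) = Σ_{k=0}^n C(n,k) 𝓛_{k,r} x^{n-k};
-- coefficient of x^j is C(n,n-j) 𝓛_{n-j,r} for j ≤ n and 0 otherwise.
modLahPoly : ℕ → ℕ → Poly
modLahPoly r n j =
  if j ≤ᵇ n then (n C (n ∸ j)) * lahNum r (n ∸ j) else 0

_≡[mod_]_ : ℕ → ℕ → ℕ → Set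
a ≡[mod p ] b = (+ p) ∣ ((+ a) - (+ b))

_≋[mod_]_ : Poly → ℕ → Poly → Set
f ≋[mod p ] g = ∀ j → f j ≡[mod p ] g j

-- Modulo a prime p and for q = p ^ s, every binomial coefficient q C k with 0 < k < q is
-- divisible by p (as k · (q C k) = q · ((q − 1) C (k − 1)) and k < p ^ s), so
-- (1 + x) ^ q ≡ 1 + x ^ q and, by Pascal's rule, (n + q) C k ≡ n C k + n C (k − q).
-- Writing 𝓛_{n,r} = Σ_i (n C i) · (n + 2r − 1) P i, the terms with i ≥ q vanish because
-- p ∣ i !, and the others do not change when n is replaced by n + q; hence
-- 𝓛_{n+q,r} ≡ 𝓛_{n,r}.  Combining the two, 𝓟_{n+q,r}(x) ≡ (1 + x ^ q) 𝓟_{n,r}(x),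
-- which is iterated m times.
module Submission where

open import Defs
open import Data.Nat.Primality using (Prime; euclidsLemma; prime⇒nonZero)
open import Data.Product using (_×_; _,_)
open import Data.Nat
  using (ℕ; zero; suc; _+_; _*_; _∸_; _^_; _≤_; _<_; _≤ᵇ_; _!; _/_; _≤?_; z≤n; s≤s; z<s;
         >-nonZero; >-nonZero⁻¹)
open import Data.Nat.Properties
open import Data.Nat.Combinatorics
open import Data.Nat.Combinatorics.Specification using (k!∣nP′k)
open import Data.Nat.DivMod using (m/n*n≡m; /-congˡ; /-congʳ)
open import Data.Nat.Divisibility
  using (_∣_; divides; ∣-trans; _∣0; m∣m*n; n∣m*n; *-cancelˡ-∣; m≤n⇒m!∣n!)
open import Data.Nat.Tactic.RingSolver using (solve-∀)
import Data.Integer as ℤ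
import Data.Integer.Properties as ℤ
import Data.Integer.Divisibility.Signed as ℤ∣
import Data.Integer.Tactic.RingSolver as ℤ-Solver
open import Algebra.Properties.CommutativeSemigroup +-commutativeSemigroup
  using (interchange; x∙yz≈xz∙y; xy∙z≈xz∙y)
open import Data.Bool using (true; false; if_then_else_)
open import Data.Sum using (inj₁; inj₂)
open import Function using (_∘_)
open import Relation.Binary.Bundles using (Setoid)
open import Relation.Binary.Definitions using (tri<; tri≈; tri>)
open import Relation.Nullary using (yes; no; contradiction)
open import Relation.Nullary.Reflects using (ofʸ; ofⁿ)
open import Relation.Binary.PropositionalEquality

module Congruence (p : ℕ) where
  open import Data.Integer using (ℤ; +_)

  -- a ≡[mod p ] b, wrapped in a record so that a and b can be inferred by unification.
  infix 4 _≈_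
  record _≈_ (a b : ℕ) : Set where
    constructor mod-p
    field divides-difference : + p ℤ∣.∣ (+ a ℤ.- + b)
  open _≈_ public

  ≈⇒≡[mod] : ∀ {a b} → a ≈ b → a ≡[mod p ] b
  ≈⇒≡[mod] a≈b = ℤ∣.∣⇒∣ᵤ (divides-difference a≈b)

  ≈-by : ∀ {a b} (x : ℤ) → + p ℤ∣.∣ x → x ≡ + a ℤ.- + b → a ≈ b
  ≈-by x p∣x refl = mod-p p∣x

  ≈-reflexive : ∀ {a b} → a ≡ b → a ≈ b
  ≈-reflexive {a} refl = ≈-by (+ 0) (ℤ∣.divides (+ 0) refl) (sym (ℤ.+-inverseʳ (+ a)))

  ≈-refl : ∀ {a} → a ≈ a
  ≈-refl = ≈-reflexive refl

  ≈-sym : ∀ {a b} → a ≈ b → b ≈ a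
  ≈-sym {a} {b} (mod-p p∣a-b) = ≈-by _ (ℤ∣.∣m⇒∣-m p∣a-b) (negate (+ a) (+ b))
    where
    negate : ∀ x y → ℤ.- (x ℤ.- y) ≡ y ℤ.- x
    negate = ℤ-Solver.solve-∀

  ≈-trans : ∀ {a b c} → a ≈ b → b ≈ c → a ≈ c
  ≈-trans {a} {b} {c} (mod-p p∣a-b) (mod-p p∣b-c) =
    ≈-by _ (ℤ∣.∣m∣n⇒∣m+n p∣a-b p∣b-c) (telescope (+ a) (+ b) (+ c))
    where
    telescope : ∀ x y z → (x ℤ.- y) ℤ.+ (y ℤ.- z) ≡ x ℤ.- z
    telescope = ℤ-Solver.solve-∀

  +-cong : ∀ {a b c d} → a ≈ b → c ≈ d → a + c ≈ b + d
  +-cong {a} {b} {c} {d} (mod-p p∣a-b) (mod-p p∣c-d) =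
    ≈-by _ (ℤ∣.∣m∣n⇒∣m+n p∣a-b p∣c-d) (begin
      (+ a ℤ.- + b) ℤ.+ (+ c ℤ.- + d)    ≡⟨ regroup (+ a) (+ b) (+ c) (+ d) ⟩
      (+ a ℤ.+ + c) ℤ.- (+ b ℤ.+ + d)    ≡⟨ cong₂ ℤ._-_ (ℤ.pos-+ a c) (ℤ.pos-+ b d) ⟨
      + (a + c) ℤ.- + (b + d)            ∎)
    where
    open ≡-Reasoning
    regroup : ∀ x y z w → (x ℤ.- y) ℤ.+ (z ℤ.- w) ≡ (x ℤ.+ z) ℤ.- (y ℤ.+ w)
    regroup = ℤ-Solver.solve-∀

  *-cong : ∀ {a b c d} → a ≈ b → c ≈ d → a * c ≈ b * d
  *-cong {a} {b} {c} {d} (mod-p p∣a-b) (mod-p p∣c-d) =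
    ≈-by _ (ℤ∣.∣m∣n⇒∣m+n (ℤ∣.∣n⇒∣m*n (+ a) p∣c-d) (ℤ∣.∣m⇒∣m*n (+ d) p∣a-b)) (begin
      + a ℤ.* (+ c ℤ.- + d) ℤ.+ (+ a ℤ.- + b) ℤ.* + d  ≡⟨ regroup (+ a) (+ b) (+ c) (+ d) ⟩
      + a ℤ.* + c ℤ.- + b ℤ.* + d                      ≡⟨ cong₂ ℤ._-_ (ℤ.pos-* a c) (ℤ.pos-* b d) ⟨
      + (a * c) ℤ.- + (b * d)                          ∎)
    where
    open ≡-Reasoning
    regroup : ∀ x y z w → x ℤ.* (z ℤ.- w) ℤ.+ (x ℤ.- y) ℤ.* w ≡ x ℤ.* z ℤ.- y ℤ.* w
    regroup = ℤ-Solver.solve-∀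

  ∣⇒≈0 : ∀ {a} → p ∣ a → a ≈ 0
  ∣⇒≈0 {a} p∣a = mod-p (ℤ∣.∣ᵤ⇒∣ (subst (p ∣_) (sym (+-identityʳ a)) p∣a))

  ≈-setoid : Setoid _ _
  ≈-setoid = record
    { Carrier = ℕ ; _≈_ = _≈_
    ; isEquivalence = record { refl = ≈-refl ; sym = ≈-sym ; trans = ≈-trans } }

sumTo-preserves : ∀ {ℓ} (R : ℕ → ℕ → Set ℓ) →
                  (∀ {a b c d} → R a b → R c d → R (a + c) (b + d)) →
                  ∀ n {f g : ℕ → ℕ} → (∀ i → i ≤ n → R (f i) (g i)) → R (sumTo n f) (sumTo n g)
sumTo-preserves R +-cong zero    f~g = f~g 0 z≤n
sumTo-preserves R +-cong (suc n) f~g =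
  +-cong (sumTo-preserves R +-cong n (λ i i≤n → f~g i (m≤n⇒m≤1+n i≤n))) (f~g (suc n) ≤-refl)

sumTo-cong : ∀ n {f g : ℕ → ℕ} → (∀ i → i ≤ n → f i ≡ g i) → sumTo n f ≡ sumTo n g
sumTo-cong = sumTo-preserves _≡_ (cong₂ _+_)

sumTo-distrib-+ : ∀ n (f g : ℕ → ℕ) → sumTo n (λ i → f i + g i) ≡ sumTo n f + sumTo n g
sumTo-distrib-+ zero    f g = refl
sumTo-distrib-+ (suc n) f g =
  trans (cong (_+ (f (suc n) + g (suc n))) (sumTo-distrib-+ n f g)) (interchange (sumTo n f) (sumTo n g) _ _)

sumTo-sucˡ : ∀ n (f : ℕ → ℕ) → sumTo (suc n) f ≡ f 0 + sumTo n (f ∘ suc)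
sumTo-sucˡ zero    f = refl
sumTo-sucˡ (suc n) f = trans (cong (_+ f (2 + n)) (sumTo-sucˡ n f)) (+-assoc (f 0) _ _)

sumTo-reverse : ∀ n (f : ℕ → ℕ) → sumTo n f ≡ sumTo n (λ i → f (n ∸ i))
sumTo-reverse zero    f = refl
sumTo-reverse (suc n) f = begin
  sumTo (suc n) f                         ≡⟨ sumTo-sucˡ n f ⟩
  f 0 + sumTo n (f ∘ suc)                 ≡⟨ cong (f 0 +_) (sumTo-reverse n (f ∘ suc)) ⟩
  f 0 + sumTo n (λ i → f (suc (n ∸ i)))   ≡⟨ cong (f 0 +_) (sumTo-cong n (λ i i≤n → cong f (+-∸-assoc 1 i≤n))) ⟨
  f 0 + sumTo n (λ i → f (suc n ∸ i))     ≡⟨ +-comm (f 0) _ ⟩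
  sumTo n (λ i → f (suc n ∸ i)) + f 0     ≡⟨ cong (λ k → sumTo n (λ i → f (suc n ∸ i)) + f k) (n∸n≡0 n) ⟨
  sumTo (suc n) (λ i → f (suc n ∸ i))     ∎
  where open ≡-Reasoning

sumTo-extend : ∀ n d (f : ℕ → ℕ) → (∀ i → n < i → f i ≡ 0) → sumTo (n + d) f ≡ sumTo n f
sumTo-extend n zero    f f>n≡0 = cong (λ k → sumTo k f) (+-identityʳ n)
sumTo-extend n (suc d) f f>n≡0 rewrite +-suc n d = begin
  sumTo (n + d) f + f (suc (n + d))  ≡⟨ cong₂ _+_ (sumTo-extend n d f f>n≡0) (f>n≡0 _ (s≤s (m≤m+n n d))) ⟩
  sumTo n f + 0                      ≡⟨ +-identityʳ _ ⟩
  sumTo n f                          ∎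
  where open ≡-Reasoning

sumTo-one : ∀ j (f : ℕ → ℕ) → sumTo j (λ i → one i * f i) ≡ f 0
sumTo-one zero    f = +-identityʳ (f 0)
sumTo-one (suc j) f = trans (+-identityʳ _) (sumTo-one j f)

≤ᵇ≡true : ∀ {m n} → m ≤ n → (m ≤ᵇ n) ≡ true
≤ᵇ≡true {m} {n} m≤n with m ≤ᵇ n | ≤ᵇ-reflects-≤ m n
... | true  | _       = refl
... | false | ofⁿ m≰n = contradiction m≤n m≰n

≤ᵇ≡false : ∀ {m n} → n < m → (m ≤ᵇ n) ≡ false
≤ᵇ≡false {m} {n} n<m with m ≤ᵇ n | ≤ᵇ-reflects-≤ m n
... | true  | ofʸ m≤n = contradiction m≤n (<⇒≱ n<m)
... | false | _       = refl

-- Not definitional: suc m ≤ᵇ n unfolds to the builtin m <ᵇ n.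
≤ᵇ-suc : ∀ m n → (suc m ≤ᵇ suc n) ≡ (m ≤ᵇ n)
≤ᵇ-suc zero    n = refl
≤ᵇ-suc (suc m) n = refl

shiftBy : ℕ → Poly → Poly
shiftBy zero    f j       = f j
shiftBy (suc q) f zero    = 0
shiftBy (suc q) f (suc j) = shiftBy q f j

shiftBy-< : ∀ {q j} {f : Poly} → j < q → shiftBy q f j ≡ 0
shiftBy-< {suc q} {zero}  _         = refl
shiftBy-< {suc q} {suc j} (s≤s j<q) = shiftBy-< j<q

shiftBy-≥ : ∀ {q j} {f : Poly} → q ≤ j → shiftBy q f j ≡ f (j ∸ q)
shiftBy-≥ {zero}          _         = refl
shiftBy-≥ {suc q} {suc j} (s≤s q≤j) = shiftBy-≥ q≤j

shiftBy-preserves : ∀ {ℓ} (R : ℕ → ℕ → Set ℓ) → R 0 0 → ∀ {f g : Poly} →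
                    (∀ j → R (f j) (g j)) → ∀ q j → R (shiftBy q f j) (shiftBy q g j)
shiftBy-preserves R R00 f~g zero    j       = f~g j
shiftBy-preserves R R00 f~g (suc q) zero    = R00
shiftBy-preserves R R00 f~g (suc q) (suc j) = shiftBy-preserves R R00 f~g q j

times-xPow+1 : ℕ → Poly → Poly
times-xPow+1 q f j = shiftBy q f j + f j

xPow+1≡times-xPow+1-one : ∀ q j → xPow+1 q j ≡ times-xPow+1 q one j
xPow+1≡times-xPow+1-one q j = cong₂ _+_ (monomial q j) (constant j)
  where
  monomial : ∀ q j → (if j ≤ᵇ q then (if q ≤ᵇ j then 1 else 0) else 0) ≡ shiftBy q one j
  monomial zero    zero    = refl
  monomial zero    (suc j) = refl
  monomial (suc q) zero    = refl
  monomial (suc q) (suc j) rewrite ≤ᵇ-suc j q | ≤ᵇ-suc q j = monomial q j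
  constant : ∀ j → (if j ≤ᵇ 0 then 1 else 0) ≡ one j
  constant zero    = refl
  constant (suc j) = refl

⊛-congˡ : ∀ {f f' : Poly} → (∀ i → f i ≡ f' i) → ∀ g j → (f ⊛ g) j ≡ (f' ⊛ g) j
⊛-congˡ f≗f' g j = sumTo-cong j (λ i _ → cong (_* g (j ∸ i)) (f≗f' i))

one-⊛ : ∀ f j → (one ⊛ f) j ≡ f j
one-⊛ f j = sumTo-one j (λ i → f (j ∸ i))

shiftBy-⊛ : ∀ q f g j → (shiftBy q f ⊛ g) j ≡ shiftBy q (f ⊛ g) j
shiftBy-⊛ zero    f g j       = refl
shiftBy-⊛ (suc q) f g zero    = refl
shiftBy-⊛ (suc q) f g (suc j) = trans (sumTo-sucˡ j _) (shiftBy-⊛ q f g j)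

times-xPow+1-⊛ : ∀ q f g j → (times-xPow+1 q f ⊛ g) j ≡ times-xPow+1 q (f ⊛ g) j
times-xPow+1-⊛ q f g j = begin
  sumTo j (λ i → (shiftBy q f i + f i) * g (j ∸ i))
    ≡⟨ sumTo-cong j (λ i _ → *-distribʳ-+ (g (j ∸ i)) (shiftBy q f i) (f i)) ⟩
  sumTo j (λ i → shiftBy q f i * g (j ∸ i) + f i * g (j ∸ i))
    ≡⟨ sumTo-distrib-+ j _ _ ⟩
  (shiftBy q f ⊛ g) j + (f ⊛ g) j
    ≡⟨ cong (_+ (f ⊛ g) j) (shiftBy-⊛ q f g j) ⟩
  times-xPow+1 q (f ⊛ g) j ∎
  where open ≡-Reasoning

xPow+1-⊛ : ∀ q f j → (xPow+1 q ⊛ f) j ≡ times-xPow+1 q f j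
xPow+1-⊛ q f j = begin
  (xPow+1 q ⊛ f) j                ≡⟨ ⊛-congˡ (xPow+1≡times-xPow+1-one q) f j ⟩
  (times-xPow+1 q one ⊛ f) j      ≡⟨ times-xPow+1-⊛ q one f j ⟩
  times-xPow+1 q (one ⊛ f) j      ≡⟨ cong₂ _+_ (shiftBy-preserves _≡_ refl (one-⊛ f) q j) (one-⊛ f j) ⟩
  times-xPow+1 q f j              ∎
  where open ≡-Reasoning

xPow+1-⊛-⊛ : ∀ q f g j → ((xPow+1 q ⊛ f) ⊛ g) j ≡ times-xPow+1 q (f ⊛ g) j
xPow+1-⊛-⊛ q f g j = trans (⊛-congˡ (xPow+1-⊛ q f) g j) (times-xPow+1-⊛ q f g j)

module _ {p q : ℕ} where
  open Congruence p

  iterate-periodic : (a : ℕ → ℕ) → (∀ N → a (N + q) ≈ a N) → ∀ m n → a (n + m * q) ≈ a n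
  iterate-periodic a period zero    n = ≈-reflexive (cong a (+-identityʳ n))
  iterate-periodic a period (suc m) n =
    ≈-trans (≈-reflexive (cong a (x∙yz≈xz∙y n q (m * q))))
            (≈-trans (period (n + m * q)) (iterate-periodic a period m n))

  iterate-times-xPow+1 : (c : ℕ → Poly) → (∀ N j → c (N + q) j ≈ times-xPow+1 q (c N) j) →
                         ∀ m n j → c (n + m * q) j ≈ ((xPow+1 q ⊛^ m) ⊛ c n) j
  iterate-times-xPow+1 c step zero    n j =
    ≈-reflexive (trans (cong (λ k → c k j) (+-identityʳ n)) (sym (one-⊛ (c n) j)))
  iterate-times-xPow+1 c step (suc m) n j = begin
    c (n + (q + m * q)) j                     ≡⟨ cong (λ k → c k j) (x∙yz≈xz∙y n q (m * q)) ⟩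
    c (n + m * q + q) j                       ≈⟨ step (n + m * q) j ⟩
    times-xPow+1 q (c (n + m * q)) j          ≈⟨ +-cong (shiftBy-preserves _≈_ ≈-refl IH q j) (IH j) ⟩
    times-xPow+1 q ((xPow+1 q ⊛^ m) ⊛ c n) j  ≡⟨ xPow+1-⊛-⊛ q (xPow+1 q ⊛^ m) (c n) j ⟨
    ((xPow+1 q ⊛^ suc m) ⊛ c n) j             ∎
    where
    open import Relation.Binary.Reasoning.Setoid ≈-setoid
    IH : ∀ j → c (n + m * q) j ≈ ((xPow+1 q ⊛^ m) ⊛ c n) j
    IH = iterate-times-xPow+1 c step m n

shiftBy-pascal : ∀ n q k → shiftBy q (n C_) k + shiftBy q (n C_) (suc k) ≡ shiftBy q (suc n C_) (suc k)
shiftBy-pascal n zero          k       = nCk+nC[k+1]≡[n+1]C[k+1] n k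
shiftBy-pascal n (suc zero)    zero    = refl
shiftBy-pascal n (suc (suc q)) zero    = refl
shiftBy-pascal n (suc q)       (suc k) = shiftBy-pascal n q k

[1+k]*[1+n]C[1+k]≡[1+n]*nCk : ∀ n k → suc k * (suc n C suc k) ≡ suc n * (n C k)
[1+k]*[1+n]C[1+k]≡[1+n]*nCk zero    zero    = refl
[1+k]*[1+n]C[1+k]≡[1+n]*nCk zero    (suc k) = *-zeroʳ (2 + k)
[1+k]*[1+n]C[1+k]≡[1+n]*nCk (suc n) zero    =
  trans (*-identityˡ _) (trans (nC1≡n (2 + n)) (sym (*-identityʳ (2 + n))))
[1+k]*[1+n]C[1+k]≡[1+n]*nCk (suc n) (suc k) = begin
  (2 + k) * ((2 + n) C (2 + k))        ≡⟨ cong ((2 + k) *_) (nCk+nC[k+1]≡[n+1]C[k+1] (suc n) (suc k)) ⟨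
  (2 + k) * (a + b)                    ≡⟨ split-left k a b ⟩
  (1 + k) * a + a + (2 + k) * b        ≡⟨ cong₂ (λ x y → x + a + y) ([1+k]*[1+n]C[1+k]≡[1+n]*nCk n k)
                                                                   ([1+k]*[1+n]C[1+k]≡[1+n]*nCk n (suc k)) ⟩
  (1 + n) * c + a + (1 + n) * d        ≡⟨ cong (λ x → (1 + n) * c + x + (1 + n) * d) (nCk+nC[k+1]≡[n+1]C[k+1] n k) ⟨
  (1 + n) * c + (c + d) + (1 + n) * d  ≡⟨ merge-right n c d ⟩
  (2 + n) * (c + d)                    ≡⟨ cong ((2 + n) *_) (nCk+nC[k+1]≡[n+1]C[k+1] n k) ⟩
  (2 + n) * ((1 + n) C (1 + k))        ∎
  where
  open ≡-Reasoning
  a = suc n C suc k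
  b = suc n C suc (suc k)
  c = n C k
  d = n C suc k
  split-left : ∀ k a b → (2 + k) * (a + b) ≡ (1 + k) * a + a + (2 + k) * b
  split-left = solve-∀
  merge-right : ∀ n c d → (1 + n) * c + (c + d) + (1 + n) * d ≡ (2 + n) * (c + d)
  merge-right = solve-∀

q∣k*qCk : ∀ {q k} → k < q → q ∣ k * (q C k)
q∣k*qCk {suc q} {zero}  _ = suc q ∣0
q∣k*qCk {suc q} {suc k} _ = divides (q C k) (trans ([1+k]*[1+n]C[1+k]≡[1+n]*nCk q k) (*-comm (suc q) (q C k)))

p^s∣k*x⇒p∣x : ∀ {p} → Prime p → ∀ s {k x} → 0 < k → k < p ^ s → p ^ s ∣ k * x → p ∣ x
p^s∣k*x⇒p∣x pp zero    0<k k<1 _ = contradiction (≤-pred k<1) (<⇒≱ 0<k)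
p^s∣k*x⇒p∣x {p} pp (suc s) {k} {x} 0<k k<p^[1+s] p^[1+s]∣k*x
  with euclidsLemma k x pp (∣-trans (m∣m*n (p ^ s)) p^[1+s]∣k*x)
... | inj₂ p∣x = p∣x
... | inj₁ (divides k′ refl) = p^s∣k*x⇒p∣x pp s 0<k′ k′<p^s p^s∣k′*x
  where
  instance _ = prime⇒nonZero pp
  0<k′ : 0 < k′
  0<k′ = >-nonZero⁻¹ k′ {{m*n≢0⇒m≢0 k′ {{>-nonZero 0<k}}}}
  k′<p^s : k′ < p ^ s
  k′<p^s = *-cancelʳ-< p k′ (p ^ s) (subst (k′ * p <_) (*-comm p (p ^ s)) k<p^[1+s])
  p^s∣k′*x : p ^ s ∣ k′ * x
  p^s∣k′*x = *-cancelˡ-∣ p (subst (p * p ^ s ∣_) (trans (cong (_* x) (*-comm k′ p)) (*-assoc p k′ x)) p^[1+s]∣k*x)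

p∣[p^s]Ck : ∀ {p} → Prime p → ∀ s {k} → 0 < k → k < p ^ s → p ∣ (p ^ s) C k
p∣[p^s]Ck pp s 0<k k<p^s = p^s∣k*x⇒p∣x pp s 0<k k<p^s (q∣k*qCk k<p^s)

one-pos : ∀ {i} → 0 < i → one i ≡ 0
one-pos {suc i} _ = refl

module _ {p : ℕ} where
  open Congruence p

  binomial≈xPow+1 : ∀ q → 0 < q → (∀ {k} → 0 < k → k < q → p ∣ q C k) →
                    ∀ k → (q C k) ≈ times-xPow+1 q one k
  binomial≈xPow+1 (suc q) _ p∣qCk zero    = ≈-refl
  binomial≈xPow+1 (suc q) _ p∣qCk (suc k) with <-cmp (suc k) (suc q)
  ... | tri< k<q _ _ = ≈-trans (∣⇒≈0 (p∣qCk z<s k<q))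
                               (≈-reflexive (sym (trans (+-identityʳ _) (shiftBy-< k<q))))
  ... | tri≈ _ refl _ = ≈-reflexive (trans (nCn≡1 (suc q)) (sym (begin
    shiftBy (suc q) one (suc q) + 0  ≡⟨ +-identityʳ _ ⟩
    shiftBy (suc q) one (suc q)      ≡⟨ shiftBy-≥ {suc q} {suc q} {one} ≤-refl ⟩
    one (q ∸ q)                      ≡⟨ cong one (n∸n≡0 q) ⟩
    1                                ∎)))
    where open ≡-Reasoning
  ... | tri> _ _ q<k = ≈-reflexive (trans (k>n⇒nCk≡0 q<k) (sym (begin
    shiftBy (suc q) one (suc k) + 0  ≡⟨ +-identityʳ _ ⟩
    shiftBy (suc q) one (suc k)      ≡⟨ shiftBy-≥ (<⇒≤ q<k) ⟩
    one (k ∸ q)                      ≡⟨ one-pos (m<n⇒0<n∸m q<k) ⟩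
    0                                ∎)))
    where open ≡-Reasoning

  frobenius : Prime p → ∀ s k → ((p ^ s) C k) ≈ times-xPow+1 (p ^ s) one k
  frobenius pp s = binomial≈xPow+1 (p ^ s) (m^n>0 p s) (p∣[p^s]Ck pp s)
    where instance _ = prime⇒nonZero pp

k!∣nPk : ∀ n k → k ! ∣ n P k
k!∣nPk n k with k ≤ᵇ n | ≤ᵇ-reflects-≤ k n
... | true  | ofʸ k≤n = k!∣nP′k k≤n
... | false | _       = (k !) ∣0

nPk≡nCk*k! : ∀ n k → n P k ≡ (n C k) * k !
nPk≡nCk*k! n k with k ≤? n
... | yes k≤n = sym (trans (cong (_* k !) (nCk≡nPk/k! k≤n)) (m/n*n≡m {{k !≢0}} (k!∣nPk n k)))
... | no  k≰n = trans (k>n⇒nPk≡0 (≰⇒> k≰n)) (cong (_* k !) (sym (k>n⇒nCk≡0 (≰⇒> k≰n))))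

p∣nPk : ∀ {p} → 0 < p → ∀ n {k} → p ≤ k → p ∣ n P k
p∣nPk {suc p} _ n {k} p≤k =
  subst (suc p ∣_) (sym (nPk≡nCk*k! n k)) (∣-trans (∣-trans (m∣m*n (p !)) (m≤n⇒m!∣n! p≤k)) (n∣m*n (n C k)))

lahTerm : ℕ → ℕ → ℕ → ℕ
lahTerm r n i = (n C i) * ((n + (2 * r ∸ 1)) P i)

rLah-reversed : ∀ {r n i} → 1 ≤ r → i ≤ n → rLah r n (n ∸ i) ≡ lahTerm r n i
rLah-reversed {r} {n} {i} 1≤r i≤n = cong₂ _*_ (sym (nCk≡nC[n∸k] i≤n)) (begin
  (n + 2 * r ∸ 1) ! / (n ∸ i + 2 * r ∸ 1) !  ≡⟨ /-congˡ (cong _! (+-∸-assoc n 1≤2r)) ⟩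
  (n + R) ! / (n ∸ i + 2 * r ∸ 1) !          ≡⟨ /-congʳ (cong _! offset) ⟩
  (n + R) ! / (n + R ∸ i) !                  ≡⟨ nPk≡n!/[n∸k]! (≤-trans i≤n (m≤m+n n R)) ⟨
  (n + R) P i                                ∎)
  where
  open ≡-Reasoning
  R = 2 * r ∸ 1
  1≤2r : 1 ≤ 2 * r
  1≤2r = ≤-trans 1≤r (m≤m+n r (r + 0))
  offset : n ∸ i + 2 * r ∸ 1 ≡ n + R ∸ i
  offset = trans (+-∸-assoc (n ∸ i) 1≤2r) (sym (+-∸-comm R i≤n))
  instance
    _ = (n ∸ i + 2 * r ∸ 1) !≢0
    _ = (n + R ∸ i) !≢0

lahNum≡sumTo-lahTerm : ∀ {r} → 1 ≤ r → ∀ n → lahNum r n ≡ sumTo n (lahTerm r n)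
lahNum≡sumTo-lahTerm {r} 1≤r n =
  trans (sumTo-reverse n (rLah r n)) (sumTo-cong n (λ i i≤n → rLah-reversed 1≤r i≤n))

modLahPoly-coeff : ∀ r n j → modLahPoly r n j ≡ (n C j) * lahNum r (n ∸ j)
modLahPoly-coeff r n j with j ≤? n
... | yes j≤n = trans (cong branch (≤ᵇ≡true j≤n)) (cong (_* lahNum r (n ∸ j)) (sym (nCk≡nC[n∸k] j≤n)))
  where branch = λ b → if b then (n C (n ∸ j)) * lahNum r (n ∸ j) else 0
... | no  j≰n = trans (cong branch (≤ᵇ≡false (≰⇒> j≰n))) (cong (_* lahNum r (n ∸ j)) (sym (k>n⇒nCk≡0 (≰⇒> j≰n))))
  where branch = λ b → if b then (n C (n ∸ j)) * lahNum r (n ∸ j) else 0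

[n+q]∸j≡n∸[j∸q] : ∀ n {q j} → q ≤ j → n + q ∸ j ≡ n ∸ (j ∸ q)
[n+q]∸j≡n∸[j∸q] n {q} {j} q≤j = begin
  n + q ∸ j              ≡⟨ cong (n + q ∸_) (m+[n∸m]≡n q≤j) ⟨
  n + q ∸ (q + (j ∸ q))  ≡⟨ ∸-+-assoc (n + q) q (j ∸ q) ⟨
  n + q ∸ q ∸ (j ∸ q)    ≡⟨ cong (_∸ (j ∸ q)) (m+n∸n≡m n q) ⟩
  n ∸ (j ∸ q)            ∎
  where open ≡-Reasoning

shiftBy-lahCoeff : ∀ r n {q} j → shiftBy q (n C_) j * lahNum r (n + q ∸ j) ≡ shiftBy q (modLahPoly r n) j
shiftBy-lahCoeff r n {q} j with q ≤? j
... | yes q≤j = begin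
  shiftBy q (n C_) j * lahNum r (n + q ∸ j)  ≡⟨ cong₂ _*_ (shiftBy-≥ q≤j) (cong (lahNum r) ([n+q]∸j≡n∸[j∸q] n q≤j)) ⟩
  (n C (j ∸ q)) * lahNum r (n ∸ (j ∸ q))     ≡⟨ modLahPoly-coeff r n (j ∸ q) ⟨
  modLahPoly r n (j ∸ q)                     ≡⟨ shiftBy-≥ q≤j ⟨
  shiftBy q (modLahPoly r n) j               ∎
  where open ≡-Reasoning
... | no  q≰j = trans (cong (_* lahNum r (n + q ∸ j)) (shiftBy-< (≰⇒> q≰j))) (sym (shiftBy-< (≰⇒> q≰j)))

module _ {p : ℕ} where
  open Congruence p

  module Periodicity {q : ℕ} (0<p : 0 < p) (p≤q : p ≤ q)
                     (frob : ∀ k → (q C k) ≈ times-xPow+1 q one k) where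
    open import Relation.Binary.Reasoning.Setoid ≈-setoid

    binomial-shift : ∀ n k → ((n + q) C k) ≈ times-xPow+1 q (n C_) k
    binomial-shift zero    k       =
      ≈-trans (frob k) (≈-reflexive (cong₂ _+_ (shiftBy-preserves _≡_ refl one≡0C q k) (one≡0C k)))
      where
      one≡0C : ∀ k → one k ≡ 0 C k
      one≡0C zero    = refl
      one≡0C (suc k) = refl
    binomial-shift (suc n) zero    = ≈-reflexive (sym (cong (_+ 1) (shiftBy-< (<-≤-trans 0<p p≤q))))
    binomial-shift (suc n) (suc k) = begin
      suc (n + q) C suc k                                  ≡⟨ nCk+nC[k+1]≡[n+1]C[k+1] (n + q) k ⟨
      (n + q) C k + (n + q) C suc k                        ≈⟨ +-cong (binomial-shift n k) (binomial-shift n (suc k)) ⟩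
      (S k + n C k) + (S (suc k) + n C suc k)              ≡⟨ interchange (S k) (n C k) (S (suc k)) (n C suc k) ⟩
      (S k + S (suc k)) + (n C k + n C suc k)              ≡⟨ cong₂ _+_ (shiftBy-pascal n q k) (nCk+nC[k+1]≡[n+1]C[k+1] n k) ⟩
      times-xPow+1 q (suc n C_) (suc k)                    ∎
      where
      S : ℕ → ℕ
      S = shiftBy q (n C_)

    binomial-below : ∀ n {k} → k < q → ((n + q) C k) ≈ n C k
    binomial-below n {k} k<q =
      ≈-trans (binomial-shift n k) (≈-reflexive (cong (_+ n C k) (shiftBy-< k<q)))

    falling-below : ∀ n {k} → k < q → ((n + q) P k) ≈ n P k
    falling-below n {k} k<q = begin
      (n + q) P k          ≡⟨ nPk≡nCk*k! (n + q) k ⟩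
      ((n + q) C k) * k !  ≈⟨ *-cong (binomial-below n k<q) ≈-refl ⟩
      (n C k) * k !        ≡⟨ nPk≡nCk*k! n k ⟨
      n P k                ∎

    lahTerm-periodic : ∀ r n i → lahTerm r (n + q) i ≈ lahTerm r n i
    lahTerm-periodic r n i with q ≤? i
    ... | yes q≤i = ≈-trans (vanishes (n + q)) (≈-sym (vanishes n))
      where
      vanishes : ∀ m → lahTerm r m i ≈ 0
      vanishes m = ≈-trans (*-cong (≈-refl {m C i}) (∣⇒≈0 (p∣nPk 0<p _ (≤-trans p≤q q≤i))))
                           (≈-reflexive (*-zeroʳ (m C i)))
    ... | no  q≰i = *-cong (binomial-below n (≰⇒> q≰i)) (begin
      (n + q + R) P i  ≡⟨ cong (_P i) (xy∙z≈xz∙y n q R) ⟩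
      (n + R + q) P i  ≈⟨ falling-below (n + R) (≰⇒> q≰i) ⟩
      (n + R) P i      ∎)
      where
      R = 2 * r ∸ 1

    lah-periodic : ∀ {r} → 1 ≤ r → ∀ n → lahNum r (n + q) ≈ lahNum r n
    lah-periodic {r} 1≤r n = begin
      lahNum r (n + q)                  ≡⟨ lahNum≡sumTo-lahTerm 1≤r (n + q) ⟩
      sumTo (n + q) (lahTerm r (n + q)) ≈⟨ sumTo-preserves _≈_ +-cong (n + q) (λ i _ → lahTerm-periodic r n i) ⟩
      sumTo (n + q) (lahTerm r n)       ≡⟨ sumTo-extend n q (lahTerm r n) (λ i n<i → cong (_* ((n + R) P i)) (k>n⇒nCk≡0 n<i)) ⟩
      sumTo n (lahTerm r n)             ≡⟨ lahNum≡sumTo-lahTerm 1≤r n ⟨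
      lahNum r n                        ∎
      where
      R = 2 * r ∸ 1

    lahCoeff-periodic : ∀ {r} → 1 ≤ r → ∀ n j → (n C j) * lahNum r (n + q ∸ j) ≈ modLahPoly r n j
    lahCoeff-periodic {r} 1≤r n j with j ≤? n
    ... | yes j≤n = begin
      (n C j) * lahNum r (n + q ∸ j)  ≡⟨ cong (λ k → (n C j) * lahNum r k) (+-∸-comm q j≤n) ⟩
      (n C j) * lahNum r (n ∸ j + q)  ≈⟨ *-cong (≈-refl {n C j}) (lah-periodic 1≤r (n ∸ j)) ⟩
      (n C j) * lahNum r (n ∸ j)      ≡⟨ modLahPoly-coeff r n j ⟨
      modLahPoly r n j                ∎
    ... | no  j≰n = begin
      (n C j) * lahNum r (n + q ∸ j)  ≡⟨ cong (_* lahNum r (n + q ∸ j)) (k>n⇒nCk≡0 (≰⇒> j≰n)) ⟩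
      0                               ≡⟨ cong (_* lahNum r (n ∸ j)) (k>n⇒nCk≡0 (≰⇒> j≰n)) ⟨
      (n C j) * lahNum r (n ∸ j)      ≡⟨ modLahPoly-coeff r n j ⟨
      modLahPoly r n j                ∎

    modLahPoly-recurrence : ∀ {r} → 1 ≤ r → ∀ n j →
                            modLahPoly r (n + q) j ≈ times-xPow+1 q (modLahPoly r n) j
    modLahPoly-recurrence {r} 1≤r n j = begin
      modLahPoly r (n + q) j                               ≡⟨ modLahPoly-coeff r (n + q) j ⟩
      ((n + q) C j) * L (n + q ∸ j)                        ≈⟨ *-cong (binomial-shift n j) ≈-refl ⟩
      (shiftBy q (n C_) j + n C j) * L (n + q ∸ j)         ≡⟨ *-distribʳ-+ (L (n + q ∸ j)) (shiftBy q (n C_) j) (n C j) ⟩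
      shiftBy q (n C_) j * L (n + q ∸ j) + (n C j) * L (n + q ∸ j)
                                                           ≈⟨ +-cong (≈-reflexive (shiftBy-lahCoeff r n {q} j)) (lahCoeff-periodic 1≤r n j) ⟩
      times-xPow+1 q (modLahPoly r n) j                    ∎
      where
      L = lahNum r

corollary8 : (r n s m p : ℕ) → 1 ≤ r → 1 ≤ n → 1 ≤ s → Prime p → 3 ≤ p →
    (modLahPoly r (n + m * p ^ s) ≋[mod p ] ((xPow+1 (p ^ s) ⊛^ m) ⊛ modLahPoly r n))
    × (lahNum r (n + m * p ^ s) ≡[mod p ] lahNum r n)
corollary8 r n s m p 1≤r _ 1≤s pp _ =
    (λ j → ≈⇒≡[mod] (iterate-times-xPow+1 {q = p ^ s} (modLahPoly r) (modLahPoly-recurrence 1≤r) m n j))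
  , ≈⇒≡[mod] (iterate-periodic {q = p ^ s} (lahNum r) (lah-periodic 1≤r) m n)
  where
  instance _ = prime⇒nonZero pp
  open Congruence p
  open Periodicity (>-nonZero⁻¹ p) (subst (_≤ p ^ s) (*-identityʳ p) (^-monoʳ-≤ p 1≤s)) (frobenius pp s)
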